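{- Let $G$ and $H$ be finite graphs and let $D$ be a dominating set of $G\Box H$. If there exist dominating sets $S_1$ and $S_2$ of $G$ such that for every $h\in V(H)$ we have $S_i\in M_G(p_G(D\cap G_h))$ for some $i\in\{1,2\}$, then $|D|\geq \gamma(G)\gamma(H)$.
   Context: $\gamma(X)$ denotes the domination number of a graph $X$ (the minimum size of a dominating set). $G\Box H$ is the Cartesian product of $G$ and $H$. For $h\in V(H)$, $G_h=\{(g,h)\mid g\in V(G)\}$ is the $G$-layer at $h$. The projection $p_G:V(G\Box H)\to V(G)$ is $p_G(g,h)=g$. For $X\subseteq V(G)$, a minimal dominating set of $G$ containing $X$ is a dominating set $S$ of $G$ with $X\subseteq S$ such that no set $S'$ with $X\subseteq S'\subsetneq S$ is a dominating set of $G$; $M_G(X)$ denotes the set of all minimal dominating sets of $G$ containing $X$. -}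

module Defs where

open import Data.Nat using (ℕ; _*_; _≤_)
open import Data.Fin using (Fin; combine; remQuot)
open import Data.Fin.Subset using (Subset; _∈_; _∉_; _⊆_; _⊂_; ∣_∣)
open import Data.Vec using (tabulate)
open import Data.Bool using (Bool; true; false)
open import Data.Product using (Σ; ∃; _×_; _,_; proj₁; proj₂)
open import Data.Sum using (_⊎_)
open import Relation.Binary.PropositionalEquality using (_≡_)
open import Relation.Nullary using (¬_)

record Graph : Set₁ where
  field
    n     : ℕ
    Adj   : Fin n → Fin n → Set
    sym   : ∀ {u v} → Adj u v → Adj v u
    irrefl : ∀ {u} → ¬ Adj u u
open Graph public

VSet : Graph → Set
VSet G = Subset (n G)

Dominating : (G : Graph) → VSet G → Set
Dominating G S = ∀ v → v ∈ S ⊎ (∃ λ u → u ∈ S × Adj G v u)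

IsDominationNumber : Graph → ℕ → Set
IsDominationNumber G k =
  (Σ (VSet G) λ S → Dominating G S × ∣ S ∣ ≡ k)
  × (∀ S → Dominating G S → k ≤ ∣ S ∣)

MinDomContaining : (G : Graph) → VSet G → VSet G → Set
MinDomContaining G X S =
  Dominating G S × X ⊆ S
  × (∀ S′ → X ⊆ S′ → S′ ⊂ S → ¬ Dominating G S′)

-- Cartesian product G □ H, vertex (g,h) encoded as combine g h : Fin (n G * n H)
_□_ : Graph → Graph → Graph
G □ H = record
  { n = n G * n H
  ; Adj = λ x y → PAdj (remQuot (n H) x) (remQuot (n H) y)
  ; sym = λ {x} {y} → psym (remQuot (n H) x) (remQuot (n H) y)
  ; irrefl = λ {x} → pirr (remQuot (n H) x)
  }
  where
  PAdj : Fin (n G) × Fin (n H) → Fin (n G) × Fin (n H) → Set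
  PAdj (g , h) (g′ , h′) = (g ≡ g′ × Adj H h h′) ⊎ (Adj G g g′ × h ≡ h′)
  psym : ∀ a b → PAdj a b → PAdj b a
  psym (g , h) (g′ , h′) (Data.Sum.inj₁ (Relation.Binary.PropositionalEquality.refl , a)) =
    Data.Sum.inj₁ (Relation.Binary.PropositionalEquality.refl , sym H a)
  psym (g , h) (g′ , h′) (Data.Sum.inj₂ (a , Relation.Binary.PropositionalEquality.refl)) =
    Data.Sum.inj₂ (sym G a , Relation.Binary.PropositionalEquality.refl)
  pirr : ∀ a → ¬ PAdj a a
  pirr (g , h) (Data.Sum.inj₁ (_ , a)) = irrefl H a
  pirr (g , h) (Data.Sum.inj₂ (a , _)) = irrefl G a

layerProj : (G H : Graph) → VSet (G □ H) → Fin (n H) → VSet G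
layerProj G H D h = tabulate λ g → Data.Vec.lookup D (combine g h)

-- If s ∈ S₁ is missing from a layer X_h over which S₁ is minimal, then S₁ − s no
-- longer dominates G, which yields an S₁-private neighbour π₁ s of s; likewise π₂
-- for S₂. For s ∈ S₁ and t ∈ S₂ choose in every layer X_h the vertex s, or failing
-- that π₂ t, when S₁ ∈ M(X_h), and t, or failing that π₁ s, when S₂ ∈ M(X_h).
-- The layers h where the chosen vertex lies in X_h dominate H: if layer h fails
-- with S₁ ∈ M(X_h), then (π₁ s, h) cannot be dominated inside its G-layer (the
-- only vertex of S₁ ⊇ X_h near π₁ s is s), so some (π₁ s, h′) with h′ ~ h lies in
-- D, and privacy makes layer h′ succeed. Hence each pair (s, t) owns at least γ(H)
-- vertices of D. The relation "π₁ s = t or π₂ t = s" is a partial matching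
-- between S₁ and S₂, and pairing off γ(G) elements of each side greedily,
-- matched pairs first, makes the owned sets pairwise disjoint.
module Submission where

open import Defs hiding (sym)
open import Data.Bool using (Bool; true)
open import Data.Empty using (⊥-elim)
open import Data.Fin using (Fin; zero; suc; combine; remQuot; _≟_)
open import Data.Fin.Properties
  using (any?; 0≢1+n; suc-injective; remQuot-combine; combine-remQuot; combine-injectiveˡ; combine-injectiveʳ)
open import Data.Fin.Subset using (Subset; inside; outside; _∈_; _∉_; _⊆_; ∣_∣; _─_; _-_; Nonempty)
open import Data.Fin.Subset.Properties
  using (_∈?_; drop-∷-⊆; x∈⁅y⁆⇒x≡y; x∉⁅y⁆⇒x≢y; ∣⁅x⁆∣≡1; x∈p∧x∉q⇒x∈p─q; x∈p∧x≢y⇒x∈p-y; x∈p⇒p-x⊂p; p─q⊆p)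
open import Data.Maybe using (Maybe; just; nothing)
open import Data.Maybe.Properties using (just-injective; ≡-dec)
open import Data.Nat using (ℕ; zero; suc; _+_; _*_; _≤_; _<_; _≤?_; z≤n; s≤s; s≤s⁻¹)
open import Data.Nat.Properties using (+-suc; +-mono-≤; ≤-trans; module ≤-Reasoning)
open import Data.Product as Product using (∃; ∃₂; _×_; _,_; proj₁; proj₂; uncurry)
open import Data.Sum as Sum using (_⊎_; inj₁; inj₂; [_,_]′)
open import Data.Vec using ([]; _∷_; here; there; tabulate)
open import Data.Vec.Properties using (lookup∘tabulate; []=⇒lookup; lookup⇒[]=)
open import Function using (_∘_; const; id)
open import Function.Definitions using (Injective)
open import Relation.Binary.PropositionalEquality using (_≡_; _≢_; refl; sym; trans; cong; subst; subst₂)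
open import Relation.Nullary using (¬_; Dec; yes; no; does)
open import Relation.Nullary.Decidable using (dec-true; decidable-stable; _×-dec_; _⊎-dec_)
open import Relation.Unary using (Decidable)

private
  variable
    a b m : ℕ

∈tabulate⁺ : {f : Fin m → Bool} {x : Fin m} → f x ≡ true → x ∈ tabulate f
∈tabulate⁺ {f = f} {x} fx = lookup⇒[]= x (tabulate f) (trans (lookup∘tabulate f x) fx)

∈tabulate⁻ : {f : Fin m → Bool} {x : Fin m} → x ∈ tabulate f → f x ≡ true
∈tabulate⁻ {f = f} {x} x∈ = trans (sym (lookup∘tabulate f x)) ([]=⇒lookup x∈)

select : {P : Fin m → Set} → Decidable P → Subset m
select P? = tabulate (does ∘ P?)

module _ {P : Fin m → Set} (P? : Decidable P) where

  ∈select⁺ : ∀ {x} → P x → x ∈ select P?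
  ∈select⁺ {x} px = ∈tabulate⁺ (dec-true (P? x) px)

  ∈select⁻ : ∀ {x} → x ∈ select P? → P x
  ∈select⁻ {x} x∈ with P? x | ∈tabulate⁻ {f = does ∘ P?} x∈
  ... | yes px | _ = px

module _ (f : Fin a → Fin b) (p : Subset a) where

  private
    hit? : Decidable λ y → ∃ λ x → x ∈ p × f x ≡ y
    hit? y = any? λ x → (x ∈? p) ×-dec (f x ≟ y)

  image : Subset b
  image = select hit?

  ∈image⁺ : ∀ {x} → x ∈ p → f x ∈ image
  ∈image⁺ {x} x∈p = ∈select⁺ hit? (x , x∈p , refl)

  ∈image⁻ : ∀ {y} → y ∈ image → ∃ λ x → x ∈ p × f x ≡ y
  ∈image⁻ = ∈select⁻ hit?

x∈p─q⇒x∉q : ∀ {x : Fin m} (p q : Subset m) → x ∈ p ─ q → x ∉ q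
x∈p─q⇒x∉q (_ ∷ p) (outside ∷ q) (there x∈) (there x∈q) = x∈p─q⇒x∉q p q x∈ x∈q
x∈p─q⇒x∉q (_ ∷ p) (inside ∷ q) (there x∈) (there x∈q) = x∈p─q⇒x∉q p q x∈ x∈q

x∈p-y⇒x≢y : ∀ {x y : Fin m} (p : Subset m) → x ∈ p - y → x ≢ y
x∈p-y⇒x≢y p x∈ = x∉⁅y⁆⇒x≢y (x∈p─q⇒x∉q p _ x∈)

x∈p-y⇒x∈p : ∀ {x y : Fin m} (p : Subset m) → x ∈ p - y → x ∈ p
x∈p-y⇒x∈p p x∈ = p─q⊆p p _ x∈

∣q∣≡∣p∣+∣q─p∣ : {p q : Subset m} → p ⊆ q → ∣ q ∣ ≡ ∣ p ∣ + ∣ q ─ p ∣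
∣q∣≡∣p∣+∣q─p∣ {p = []} {[]} _ = refl
∣q∣≡∣p∣+∣q─p∣ {p = inside ∷ p} {inside ∷ q} p⊆q = cong suc (∣q∣≡∣p∣+∣q─p∣ (drop-∷-⊆ p⊆q))
∣q∣≡∣p∣+∣q─p∣ {p = inside ∷ p} {outside ∷ q} p⊆q with p⊆q here
... | ()
∣q∣≡∣p∣+∣q─p∣ {p = outside ∷ p} {inside ∷ q} p⊆q =
  trans (cong suc (∣q∣≡∣p∣+∣q─p∣ (drop-∷-⊆ p⊆q))) (sym (+-suc _ _))
∣q∣≡∣p∣+∣q─p∣ {p = outside ∷ p} {outside ∷ q} p⊆q = ∣q∣≡∣p∣+∣q─p∣ (drop-∷-⊆ p⊆q)

x∈p⇒∣p∣≡1+∣p-x∣ : ∀ {x : Fin m} {p} → x ∈ p → ∣ p ∣ ≡ suc ∣ p - x ∣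
x∈p⇒∣p∣≡1+∣p-x∣ {x = x} {p} x∈p =
  trans (∣q∣≡∣p∣+∣q─p∣ λ y∈⁅x⁆ → subst (_∈ p) (sym (x∈⁅y⁆⇒x≡y x y∈⁅x⁆)) x∈p)
        (cong (_+ ∣ p - x ∣) (∣⁅x⁆∣≡1 x))

1+k≤∣p∣⇒k≤∣p-x∣ : ∀ {k} {x : Fin m} {p} → suc k ≤ ∣ p ∣ → x ∈ p → k ≤ ∣ p - x ∣
1+k≤∣p∣⇒k≤∣p-x∣ k<∣p∣ x∈p = s≤s⁻¹ (subst (_ ≤_) (x∈p⇒∣p∣≡1+∣p-x∣ x∈p) k<∣p∣)

0<∣p∣⇒Nonempty : {p : Subset m} → 0 < ∣ p ∣ → Nonempty p
0<∣p∣⇒Nonempty {p = inside ∷ p} _ = zero , here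
0<∣p∣⇒Nonempty {p = outside ∷ p} 0<∣p∣ = Product.map suc there (0<∣p∣⇒Nonempty 0<∣p∣)

injective⇒∣p∣≤∣q∣ : ∀ {p : Subset a} {q : Subset b} (f : Fin a → Fin b) →
  Injective _≡_ _≡_ f → (∀ {x} → x ∈ p → f x ∈ q) → ∣ p ∣ ≤ ∣ q ∣
injective⇒∣p∣≤∣q∣ {p = []} f _ _ = z≤n
injective⇒∣p∣≤∣q∣ {p = outside ∷ p} f f-inj p→q =
  injective⇒∣p∣≤∣q∣ (f ∘ suc) (suc-injective ∘ f-inj) (p→q ∘ there)
injective⇒∣p∣≤∣q∣ {p = inside ∷ p} {q} f f-inj p→q =
  subst (suc ∣ p ∣ ≤_) (sym (x∈p⇒∣p∣≡1+∣p-x∣ (p→q here)))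
    (s≤s (injective⇒∣p∣≤∣q∣ (f ∘ suc) (suc-injective ∘ f-inj)
      λ x∈p → x∈p∧x≢y⇒x∈p-y (p→q (there x∈p)) (0≢1+n ∘ sym ∘ f-inj)))

∣p∣≤∣image∣ : ∀ {p : Subset a} (f : Fin a → Fin b) → Injective _≡_ _≡_ f → ∣ p ∣ ≤ ∣ image f p ∣
∣p∣≤∣image∣ f f-inj = injective⇒∣p∣≤∣q∣ f f-inj (∈image⁺ f _)

¬¬-∀Fin : {P : Fin m → Set} → (∀ i → ¬ ¬ P i) → ¬ ¬ (∀ i → P i)
¬¬-∀Fin {m = zero} _ k = k λ ()
¬¬-∀Fin {m = suc m} ¬¬P k =
  ¬¬P zero λ p₀ → ¬¬-∀Fin (¬¬P ∘ suc) λ ps → k λ { zero → p₀ ; (suc i) → ps i }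

candidate : Subset m → Fin m → Maybe (Fin m) → Fin m
candidate Y s nothing = s
candidate Y s (just u) with s ∈? Y
... | yes _ = s
... | no _ = u

module _ (Y : Subset m) (s : Fin m) where

  candidate-∈ˡ : ∀ u? → s ∈ Y → candidate Y s u? ∈ Y
  candidate-∈ˡ nothing s∈Y = s∈Y
  candidate-∈ˡ (just u) s∈Y with s ∈? Y
  ... | yes _ = s∈Y
  ... | no s∉Y = ⊥-elim (s∉Y s∈Y)

  candidate-∈ʳ : ∀ {u? u} → u? ≡ just u → u ∈ Y → candidate Y s u? ∈ Y
  candidate-∈ʳ refl u∈Y with s ∈? Y
  ... | yes s∈Y = s∈Y
  ... | no _ = u∈Y

  candidate-cases : ∀ u? → candidate Y s u? ≡ s ⊎ u? ≡ just (candidate Y s u?)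
  candidate-cases nothing = inj₁ refl
  candidate-cases (just u) with s ∈? Y
  ... | yes _ = inj₁ refl
  ... | no _ = inj₂ refl

nothing-or-just : ∀ {A : Set} (x : Maybe A) → x ≡ nothing ⊎ ∃ λ u → x ≡ just u
nothing-or-just nothing = inj₁ refl
nothing-or-just (just u) = inj₂ (u , refl)

ClosedAdj : (G : Graph) → Fin (n G) → Fin (n G) → Set
ClosedAdj G u v = u ≡ v ⊎ Adj G u v

closedAdj-sym : ∀ G {u v} → ClosedAdj G u v → ClosedAdj G v u
closedAdj-sym G (inj₁ u≡v) = inj₁ (sym u≡v)
closedAdj-sym G (inj₂ u~v) = inj₂ (Graph.sym G u~v)

closedAdj⇒dominated : ∀ G {S v x} → x ∈ S → ClosedAdj G v x → v ∈ S ⊎ ∃ λ u → u ∈ S × Adj G v u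
closedAdj⇒dominated G x∈S (inj₁ refl) = inj₁ x∈S
closedAdj⇒dominated G x∈S (inj₂ v~x) = inj₂ (_ , x∈S , v~x)

dominated⇒closedAdj : ∀ G {S v} → v ∈ S ⊎ (∃ λ u → u ∈ S × Adj G v u) → ∃ λ x → x ∈ S × ClosedAdj G v x
dominated⇒closedAdj G (inj₁ v∈S) = _ , v∈S , inj₁ refl
dominated⇒closedAdj G (inj₂ (u , u∈S , v~u)) = u , u∈S , inj₂ v~u

PrivateNeighbour : (G : Graph) → VSet G → Fin (n G) → Fin (n G) → Set
PrivateNeighbour G S s u = ClosedAdj G s u × (∀ {x} → x ∈ S → ClosedAdj G u x → x ≡ s)

module _ (G : Graph) where

  minimal⇒¬¬private : ∀ {X S s} → MinDomContaining G X S → s ∈ S → s ∉ X →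
    ¬ ¬ ∃ (PrivateNeighbour G S s)
  minimal⇒¬¬private {X} {S} {s} (S-dom , X⊆S , minimal) s∈S s∉X noPrivate =
    ¬¬-∀Fin dominatedWithout-s (minimal (S - s) X⊆S-s (x∈p⇒p-x⊂p s∈S))
    where
    X⊆S-s : X ⊆ S - s
    X⊆S-s x∈X = x∈p∧x≢y⇒x∈p-y (X⊆S x∈X) λ { refl → s∉X x∈X }

    dominatedWithout-s : ∀ v → ¬ ¬ (v ∈ S - s ⊎ ∃ λ u → u ∈ S - s × Adj G v u)
    dominatedWithout-s v undominated = noPrivate (v , s-near-v , only-s)
      where
      only-s : ∀ {x} → x ∈ S → ClosedAdj G v x → x ≡ s
      only-s {x} x∈S v~x with x ≟ s
      ... | yes x≡s = x≡s
      ... | no x≢s = ⊥-elim (undominated (closedAdj⇒dominated G (x∈p∧x≢y⇒x∈p-y x∈S x≢s) v~x))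

      s-near-v : ClosedAdj G s v
      s-near-v with dominated⇒closedAdj G (S-dom v)
      ... | x , x∈S , v~x = closedAdj-sym G (subst (ClosedAdj G v) (only-s x∈S v~x) v~x)

  module _ {I : Set} (X : I → VSet G) (S : VSet G) where

    InMinimalLayers : Fin (n G) → Set
    InMinimalLayers s = s ∈ S → ∀ i → MinDomContaining G (X i) S → s ∈ X i

    PrivateChoice : Set
    PrivateChoice = ∀ s → InMinimalLayers s ⊎ ∃ (PrivateNeighbour G S s)

    -- Adjacency is not decidable, so a private neighbour is only obtained under ¬ ¬.
    ¬¬privateChoice : ¬ ¬ PrivateChoice
    ¬¬privateChoice = ¬¬-∀Fin λ s noChoice → noChoice (inj₁ λ s∈S i minimal →
      decidable-stable (s ∈? X i) λ s∉Xi → minimal⇒¬¬private minimal s∈S s∉Xi (noChoice ∘ inj₂))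

    module Chosen (choice : PrivateChoice) where

      π : Fin (n G) → Maybe (Fin (n G))
      π s = [ const nothing , just ∘ proj₁ ]′ (choice s)

      π-private : ∀ {s u} → π s ≡ just u → PrivateNeighbour G S s u
      π-private {s} with choice s
      ... | inj₂ (u , u-private) = λ { refl → u-private }

      π-covered : ∀ {s} → s ∈ S → π s ≡ nothing → ∀ i → MinDomContaining G (X i) S → s ∈ X i
      π-covered {s} s∈S with choice s
      ... | inj₁ covered = const (covered s∈S)

      π-injective : ∀ {s s′ u} → s ∈ S → π s ≡ just u → π s′ ≡ just u → s ≡ s′
      π-injective s∈S πs πs′ = proj₂ (π-private πs′) s∈S (closedAdj-sym G (proj₁ (π-private πs)))

      near-π⇒∈X : ∀ {i s u g} → MinDomContaining G (X i) S → π s ≡ just u →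
        g ∈ X i → ClosedAdj G u g → s ∈ X i
      near-π⇒∈X (_ , Xi⊆S , _) πs g∈X u~g = subst (_∈ X _) (proj₂ (π-private πs) (Xi⊆S g∈X) u~g) g∈X

      candidate-collision : ∀ {t t₀ s s₀ : Fin (n G)} {Y} → t ∈ S →
        candidate Y s (π t) ≡ candidate Y s₀ (π t₀) →
        s ≡ s₀ ⊎ π t₀ ≡ just s ⊎ π t ≡ just s₀ ⊎ t ≡ t₀
      candidate-collision {t} {t₀} {s} {s₀} {Y} t∈S eq
        with candidate-cases Y s (π t) | candidate-cases Y s₀ (π t₀)
      ... | inj₁ c≡s | inj₁ c₀≡s₀ = inj₁ (trans (sym c≡s) (trans eq c₀≡s₀))
      ... | inj₁ c≡s | inj₂ πt₀ = inj₂ (inj₁ (trans πt₀ (cong just (trans (sym eq) c≡s))))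
      ... | inj₂ πt | inj₁ c₀≡s₀ = inj₂ (inj₂ (inj₁ (trans πt (cong just (trans eq c₀≡s₀)))))
      ... | inj₂ πt | inj₂ πt₀ = inj₂ (inj₂ (inj₂ (π-injective t∈S πt (trans πt₀ (cong just (sym eq))))))

module Packing {N : ℕ} (S₁ : Subset a) (S₂ : Subset b)
  (Matched : Fin a → Fin b → Set) (Matched? : ∀ s t → Dec (Matched s t))
  (matched-functional : ∀ {s t t′} → t ∈ S₂ → t′ ∈ S₂ → Matched s t → Matched s t′ → t ≡ t′)
  (matched-injective : ∀ {s s′ t} → s ∈ S₁ → s′ ∈ S₁ → Matched s t → Matched s′ t → s ≡ s′)
  (Z : Fin a → Fin b → Subset N)
  (Z-disjoint : ∀ {s t s₀ t₀} → s ∈ S₁ → t ∈ S₂ → s ≢ s₀ → t ≢ t₀ → ¬ Matched s₀ t → ¬ Matched s t₀ →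
                ∀ {y} → y ∈ Z s t → y ∉ Z s₀ t₀)
  (c : ℕ) (c≤∣Z∣ : ∀ {s t} → s ∈ S₁ → t ∈ S₂ → c ≤ ∣ Z s t ∣)
  where

  Separated : Subset a → Subset b → Fin a → Fin b → Set
  Separated R₁ R₂ s₀ t₀ =
    ∀ {s t} → s ∈ R₁ → t ∈ R₂ → s ≢ s₀ → t ≢ t₀ → ¬ Matched s₀ t × ¬ Matched s t₀

  separatedPair : ∀ {R₁ R₂} → R₁ ⊆ S₁ → R₂ ⊆ S₂ → Nonempty R₁ → Nonempty R₂ →
    ∃₂ λ s₀ t₀ → s₀ ∈ R₁ × t₀ ∈ R₂ × Separated R₁ R₂ s₀ t₀
  separatedPair {R₁} {R₂} R₁⊆S₁ R₂⊆S₂ (s₁ , s₁∈R₁) (t₁ , t₁∈R₂)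
    with any? (λ s → any? λ t → (s ∈? R₁) ×-dec ((t ∈? R₂) ×-dec Matched? s t))
  ... | yes (s₀ , t₀ , s₀∈R₁ , t₀∈R₂ , matched) =
    s₀ , t₀ , s₀∈R₁ , t₀∈R₂ , λ s∈R₁ t∈R₂ s≢s₀ t≢t₀ →
      (λ m → t≢t₀ (matched-functional (R₂⊆S₂ t∈R₂) (R₂⊆S₂ t₀∈R₂) m matched)) ,
      (λ m → s≢s₀ (matched-injective (R₁⊆S₁ s∈R₁) (R₁⊆S₁ s₀∈R₁) m matched))
  ... | no noMatch =
    s₁ , t₁ , s₁∈R₁ , t₁∈R₂ , λ {s} {t} s∈R₁ t∈R₂ _ _ →
      (λ m → noMatch (s₁ , t , s₁∈R₁ , t∈R₂ , m)) ,
      (λ m → noMatch (s , t₁ , s∈R₁ , t₁∈R₂ , m))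

  packing : ∀ k {R₁ R₂} (D : Subset N) → R₁ ⊆ S₁ → R₂ ⊆ S₂ → k ≤ ∣ R₁ ∣ → k ≤ ∣ R₂ ∣ →
    (∀ {s t} → s ∈ R₁ → t ∈ R₂ → Z s t ⊆ D) → k * c ≤ ∣ D ∣
  packing zero D _ _ _ _ _ = z≤n
  packing (suc k) {R₁} {R₂} D R₁⊆S₁ R₂⊆S₂ k<∣R₁∣ k<∣R₂∣ Z⊆D
    with separatedPair R₁⊆S₁ R₂⊆S₂ (0<∣p∣⇒Nonempty (≤-trans (s≤s z≤n) k<∣R₁∣))
                                   (0<∣p∣⇒Nonempty (≤-trans (s≤s z≤n) k<∣R₂∣))
  ... | s₀ , t₀ , s₀∈R₁ , t₀∈R₂ , separated = begin
    c + k * c                      ≤⟨ +-mono-≤ (c≤∣Z∣ (R₁⊆S₁ s₀∈R₁) (R₂⊆S₂ t₀∈R₂)) rest ⟩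
    ∣ Z s₀ t₀ ∣ + ∣ D ─ Z s₀ t₀ ∣ ≡⟨ ∣q∣≡∣p∣+∣q─p∣ (Z⊆D s₀∈R₁ t₀∈R₂) ⟨
    ∣ D ∣                          ∎
    where
    open ≤-Reasoning
    remaining⊆ : ∀ {s t} → s ∈ R₁ → t ∈ R₂ → s ≢ s₀ → t ≢ t₀ → Z s t ⊆ D ─ Z s₀ t₀
    remaining⊆ s∈R₁ t∈R₂ s≢s₀ t≢t₀ y∈Z with separated s∈R₁ t∈R₂ s≢s₀ t≢t₀
    ... | ¬m₀ , ¬m = x∈p∧x∉q⇒x∈p─q (Z⊆D s∈R₁ t∈R₂ y∈Z)
                       (Z-disjoint (R₁⊆S₁ s∈R₁) (R₂⊆S₂ t∈R₂) s≢s₀ t≢t₀ ¬m₀ ¬m y∈Z)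

    rest : k * c ≤ ∣ D ─ Z s₀ t₀ ∣
    rest = packing k (D ─ Z s₀ t₀) (R₁⊆S₁ ∘ x∈p-y⇒x∈p R₁) (R₂⊆S₂ ∘ x∈p-y⇒x∈p R₂)
      (1+k≤∣p∣⇒k≤∣p-x∣ k<∣R₁∣ s₀∈R₁) (1+k≤∣p∣⇒k≤∣p-x∣ k<∣R₂∣ t₀∈R₂)
      λ s∈ t∈ → remaining⊆ (x∈p-y⇒x∈p R₁ s∈) (x∈p-y⇒x∈p R₂ t∈) (x∈p-y⇒x≢y R₁ s∈) (x∈p-y⇒x≢y R₂ t∈)

module _ (G H : Graph) where

  ProdAdj : Fin (n G) × Fin (n H) → Fin (n G) × Fin (n H) → Set
  ProdAdj (g , h) (g′ , h′) = (g ≡ g′ × Adj H h h′) ⊎ (Adj G g g′ × h ≡ h′)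

  □-adj : ∀ {g h g′ h′} → Adj (G □ H) (combine g h) (combine g′ h′) → ProdAdj (g , h) (g′ , h′)
  □-adj {g} {h} {g′} {h′} = subst₂ ProdAdj (remQuot-combine g h) (remQuot-combine g′ h′)

  module _ (D : VSet (G □ H)) where

    X : Fin (n H) → VSet G
    X = layerProj G H D

    ∈layerProj⁺ : ∀ {g h} → combine g h ∈ D → g ∈ X h
    ∈layerProj⁺ gh∈D = ∈tabulate⁺ ([]=⇒lookup gh∈D)

    ∈layerProj⁻ : ∀ {g h} → g ∈ X h → combine g h ∈ D
    ∈layerProj⁻ g∈X = lookup⇒[]= _ D (∈tabulate⁻ g∈X)

    dominated-via-layers : Dominating (G □ H) D → ∀ g h →
      g ∈ X h ⊎ (∃ λ g′ → Adj G g g′ × g′ ∈ X h) ⊎ (∃ λ h′ → Adj H h h′ × g ∈ X h′)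
    dominated-via-layers D-dom g h with D-dom (combine g h)
    ... | inj₁ gh∈D = inj₁ (∈layerProj⁺ gh∈D)
    ... | inj₂ (y , y∈D , gh~y) =
      viaNeighbour (□-adj (subst (Adj (G □ H) _) (sym y≡) gh~y))
                   (∈layerProj⁺ (subst (_∈ D) (sym y≡) y∈D))
      where
      y≡ : uncurry combine (remQuot {n G} (n H) y) ≡ y
      y≡ = combine-remQuot {n G} (n H) y

      viaNeighbour : ∀ {g′ h′} → ProdAdj (g , h) (g′ , h′) → g′ ∈ X h′ →
        g ∈ X h ⊎ (∃ λ g′ → Adj G g g′ × g′ ∈ X h) ⊎ (∃ λ h′ → Adj H h h′ × g ∈ X h′)
      viaNeighbour (inj₁ (refl , h~h′)) g∈X = inj₂ (inj₂ (_ , h~h′ , g∈X))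
      viaNeighbour (inj₂ (g~g′ , refl)) g′∈X = inj₂ (inj₁ (_ , g~g′ , g′∈X))

    module Witnesses (D-dom : Dominating (G □ H) D) (S₁ S₂ : VSet G)
      (side : ∀ h → MinDomContaining G (X h) S₁ ⊎ MinDomContaining G (X h) S₂)
      (choice₁ : PrivateChoice G X S₁) (choice₂ : PrivateChoice G X S₂)
      where

      module OneSide (S : VSet G) (choice : PrivateChoice G X S) where
        open Chosen G X S choice public

        escape : ∀ {h s} → MinDomContaining G (X h) S → s ∈ S →
          s ∈ X h ⊎ ∃ λ h′ → Adj H h h′ × ∃ λ u → π s ≡ just u × u ∈ X h′
        escape {h} {s} minimal s∈S with s ∈? X h
        ... | yes s∈X = inj₁ s∈X
        ... | no s∉X with nothing-or-just (π s)
        ...   | inj₁ πs = ⊥-elim (s∉X (π-covered s∈S πs h minimal))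
        ...   | inj₂ (u , πs) with dominated-via-layers D-dom u h
        ...     | inj₁ u∈X = ⊥-elim (s∉X (near-π⇒∈X minimal πs u∈X (inj₁ refl)))
        ...     | inj₂ (inj₁ (g , u~g , g∈X)) = ⊥-elim (s∉X (near-π⇒∈X minimal πs g∈X (inj₂ u~g)))
        ...     | inj₂ (inj₂ (h′ , h~h′ , u∈X′)) = inj₂ (h′ , h~h′ , u , πs , u∈X′)

      module Side₁ = OneSide S₁ choice₁
      module Side₂ = OneSide S₂ choice₂

      Side : Fin (n H) → Set
      Side h = MinDomContaining G (X h) S₁ ⊎ MinDomContaining G (X h) S₂

      witnessAt : Fin (n G) → Fin (n G) → (h : Fin (n H)) → Side h → Fin (n G)
      witnessAt s t h (inj₁ _) = candidate (X h) s (Side₂.π t)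
      witnessAt s t h (inj₂ _) = candidate (X h) t (Side₁.π s)

      witness : Fin (n G) → Fin (n G) → Fin (n H) → Fin (n G)
      witness s t h = witnessAt s t h (side h)

      inLayer? : ∀ s t → Decidable λ h → witness s t h ∈ X h
      inLayer? s t h = witness s t h ∈? X h

      Layers : Fin (n G) → Fin (n G) → VSet H
      Layers s t = select (inLayer? s t)

      Owned : Fin (n G) → Fin (n G) → VSet (G □ H)
      Owned s t = image (λ h → combine (witness s t h) h) (Layers s t)

      Owned⊆D : ∀ {s t} → Owned s t ⊆ D
      Owned⊆D {s} {t} y∈ with ∈image⁻ _ (Layers s t) y∈
      ... | h , h∈Layers , refl = ∈layerProj⁻ (∈select⁻ (inLayer? s t) h∈Layers)

      module _ {s t : Fin (n G)} where

        reach₁ : ∀ {u} h → Side₁.π s ≡ just u → u ∈ X h → ∀ e → witnessAt s t h e ∈ X h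
        reach₁ h πs u∈X (inj₁ minimal) =
          candidate-∈ˡ (X h) s (Side₂.π t) (Side₁.near-π⇒∈X minimal πs u∈X (inj₁ refl))
        reach₁ h πs u∈X (inj₂ _) = candidate-∈ʳ (X h) t πs u∈X

        reach₂ : ∀ {u} h → Side₂.π t ≡ just u → u ∈ X h → ∀ e → witnessAt s t h e ∈ X h
        reach₂ h πt u∈X (inj₁ _) = candidate-∈ʳ (X h) s πt u∈X
        reach₂ h πt u∈X (inj₂ minimal) =
          candidate-∈ˡ (X h) t (Side₁.π s) (Side₂.near-π⇒∈X minimal πt u∈X (inj₁ refl))

        Layers-dominating : s ∈ S₁ → t ∈ S₂ → Dominating H (Layers s t)
        Layers-dominating s∈S₁ t∈S₂ h =
          Sum.map (∈select⁺ (inLayer? s t)) (Product.map₂ (Product.map₁ (∈select⁺ (inLayer? s t))))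
            (dominatedAt (side h))
          where
          dominatedAt : ∀ e → witnessAt s t h e ∈ X h ⊎ ∃ λ h′ → witness s t h′ ∈ X h′ × Adj H h h′
          dominatedAt (inj₁ minimal) with Side₁.escape minimal s∈S₁
          ... | inj₁ s∈X = inj₁ (candidate-∈ˡ (X h) s (Side₂.π t) s∈X)
          ... | inj₂ (h′ , h~h′ , u , πs , u∈X′) = inj₂ (h′ , reach₁ h′ πs u∈X′ (side h′) , h~h′)
          dominatedAt (inj₂ minimal) with Side₂.escape minimal t∈S₂
          ... | inj₁ t∈X = inj₁ (candidate-∈ˡ (X h) t (Side₁.π s) t∈X)
          ... | inj₂ (h′ , h~h′ , u , πt , u∈X′) = inj₂ (h′ , reach₂ h′ πt u∈X′ (side h′) , h~h′)

        γ≤∣Owned∣ : ∀ {γ} → (∀ P → Dominating H P → γ ≤ ∣ P ∣) → s ∈ S₁ → t ∈ S₂ → γ ≤ ∣ Owned s t ∣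
        γ≤∣Owned∣ γ-min s∈S₁ t∈S₂ = ≤-trans (γ-min _ (Layers-dominating s∈S₁ t∈S₂))
          (∣p∣≤∣image∣ _ λ {h} {h′} → combine-injectiveʳ (witness s t h) h (witness s t h′) h′)

      Matched : Fin (n G) → Fin (n G) → Set
      Matched s t = Side₁.π s ≡ just t ⊎ Side₂.π t ≡ just s

      Matched? : ∀ s t → Dec (Matched s t)
      Matched? s t = ≡-dec _≟_ (Side₁.π s) (just t) ⊎-dec ≡-dec _≟_ (Side₂.π t) (just s)

      matched-functional : ∀ {s t t′} → t ∈ S₂ → t′ ∈ S₂ → Matched s t → Matched s t′ → t ≡ t′
      matched-functional _ _ (inj₁ πs) (inj₁ πs′) = just-injective (trans (sym πs) πs′)
      matched-functional t∈ _ (inj₂ πt) (inj₂ πt′) = Side₂.π-injective t∈ πt πt′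
      matched-functional t∈ _ (inj₁ πs) (inj₂ πt′) =
        proj₂ (Side₂.π-private πt′) t∈ (proj₁ (Side₁.π-private πs))
      matched-functional _ t′∈ (inj₂ πt) (inj₁ πs′) =
        sym (proj₂ (Side₂.π-private πt) t′∈ (proj₁ (Side₁.π-private πs′)))

      matched-injective : ∀ {s s′ t} → s ∈ S₁ → s′ ∈ S₁ → Matched s t → Matched s′ t → s ≡ s′
      matched-injective _ _ (inj₂ πt) (inj₂ πt′) = just-injective (trans (sym πt) πt′)
      matched-injective s∈ _ (inj₁ πs) (inj₁ πs′) = Side₁.π-injective s∈ πs πs′
      matched-injective s∈ _ (inj₂ πt) (inj₁ πs′) =
        proj₂ (Side₁.π-private πs′) s∈ (proj₁ (Side₂.π-private πt))
      matched-injective _ s′∈ (inj₁ πs) (inj₂ πt′) =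
        sym (proj₂ (Side₁.π-private πs) s′∈ (proj₁ (Side₂.π-private πt′)))

      Owned-disjoint : ∀ {s t s₀ t₀} → s ∈ S₁ → t ∈ S₂ → s ≢ s₀ → t ≢ t₀ →
        ¬ Matched s₀ t → ¬ Matched s t₀ → ∀ {y} → y ∈ Owned s t → y ∉ Owned s₀ t₀
      Owned-disjoint {s} {t} {s₀} {t₀} s∈S₁ t∈S₂ s≢s₀ t≢t₀ ¬m₀ ¬m y∈ y∈₀
        with ∈image⁻ _ (Layers s t) y∈ | ∈image⁻ _ (Layers s₀ t₀) y∈₀
      ... | h , _ , eq | h₀ , _ , eq₀
        with refl ← combine-injectiveʳ (witness s t h) h (witness s₀ t₀ h₀) h₀ (trans eq (sym eq₀)) =
        collision (side h) (combine-injectiveˡ (witness s t h) h (witness s₀ t₀ h) h (trans eq (sym eq₀)))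
        where
        collision : ∀ e → witnessAt s t h e ≢ witnessAt s₀ t₀ h e
        collision (inj₁ _) same =
          [ s≢s₀ , [ ¬m ∘ inj₂ , [ ¬m₀ ∘ inj₂ , t≢t₀ ]′ ]′ ]′ (Side₂.candidate-collision t∈S₂ same)
        collision (inj₂ _) same =
          [ t≢t₀ , [ ¬m₀ ∘ inj₁ , [ ¬m ∘ inj₁ , s≢s₀ ]′ ]′ ]′ (Side₁.candidate-collision s∈S₁ same)

theorem2 : (G H : Graph) (D : VSet (G □ H)) → Dominating (G □ H) D →
    (S₁ S₂ : VSet G) → Dominating G S₁ → Dominating G S₂ →
    (∀ (h : Fin (n H)) → MinDomContaining G (layerProj G H D h) S₁
                       ⊎ MinDomContaining G (layerProj G H D h) S₂) →
    (γG γH : ℕ) → IsDominationNumber G γG → IsDominationNumber H γH →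
    γG * γH ≤ ∣ D ∣
theorem2 G H D D-dom S₁ S₂ S₁-dom S₂-dom side γG γH (_ , γG-min) (_ , γH-min) =
  decidable-stable (γG * γH ≤? ∣ D ∣) λ ¬bound →
  ¬¬privateChoice G (layerProj G H D) S₁ λ choice₁ →
  ¬¬privateChoice G (layerProj G H D) S₂ λ choice₂ →
  let open Witnesses G H D D-dom S₁ S₂ side choice₁ choice₂
      open Packing S₁ S₂ Matched Matched? matched-functional matched-injective
                   Owned Owned-disjoint γH (γ≤∣Owned∣ γH-min)
  in ¬bound (packing γG D id id (γG-min S₁ S₁-dom) (γG-min S₂ S₂-dom) λ _ _ → Owned⊆D)
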